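{- Let $T$ be a tree with vertices $v_1,\dots,v_n$, fix $i\le n$, and let $T^{(i)}$ be the directed tree obtained from $T$ by directing every edge away from $v_i$. Define multipliers on the directed edges of $T^{(i)}$ recursively (from the leaves towards $v_i$) by \[ m_{pk}=d_k+1-\sum_{j:(v_k,v_j)\in\delta^+(v_k)}\frac{1}{m_{kj}} \] for each directed edge $(v_p,v_k)$ (so $m_{pk}=2$ when $v_k$ is a pendant vertex). Then for every directed edge $(v_p,v_k)$ of $T^{(i)}$, \[ 2\le \tfrac12 d_k+\tfrac32\le m_{pk}\le d_k+1, \] and if $v_k$ is a pendant vertex then equality holds throughout, so $m_{pk}=2$.
   Context: $d_k$ denotes the degree of $v_k$ in $T$; $\delta^+(v_k)$ is the set of outgoing edges $(v_k,v_s)$ of $v_k$ in $T^{(i)}$ (empty sums are $0$). A pendant vertex is a vertex of degree $1$. These multipliers satisfy $m_{pk}=x_p/x_k$, where $x$ is the $i$-th column of $(L_T+I_n)^{ -1}$ and $L_T$ the Laplacian matrix of $T$. -}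

module Defs where

open import Data.Nat as ℕ using (ℕ; zero; suc)
open import Data.Fin using (Fin)
open import Data.Bool using (Bool; true; false; T; if_then_else_)
open import Data.List using (List; []; _∷_; length; map; allFin; foldr)
open import Data.Nat.ListAction using (sum)
open import Data.Empty using (⊥)
open import Data.Product using (Σ; _×_)
open import Data.Integer using (+_)
open import Data.Rational as ℚ using (ℚ; 0ℚ)
open import Data.List.Membership.Propositional using (_∉_)
open import Data.List.Relation.Unary.Unique.Propositional using (Unique)
open import Relation.Binary.PropositionalEquality using (_≡_)
open import Relation.Nullary using (yes; no)

record Graph (n : ℕ) : Set where
  field
    adj    : Fin n → Fin n → Bool
    sym    : ∀ u v → adj u v ≡ adj v u
    irrefl : ∀ u → adj u u ≡ false

module _ {n : ℕ} (G : Graph n) where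
  open Graph G

  Adj : Fin n → Fin n → Set
  Adj u v = T (adj u v)

  data Walk : Fin n → Fin n → Set where
    here : ∀ {u} → Walk u u
    step : ∀ {u w} (v : Fin n) → Adj u v → Walk v w → Walk u w

  verts : ∀ {u w} → Walk u w → List (Fin n)
  verts {u} here         = u ∷ []
  verts {u} (step v a w) = u ∷ verts w

  inner : ∀ {u w} → Walk u w → List (Fin n)
  inner here         = []
  inner (step v a w) = verts w

  Connected : Set
  Connected = ∀ u v → Walk u v

  IsCycle : ∀ {u} → Walk u u → Set
  IsCycle w = Unique (inner w) × (3 ℕ.≤ length (inner w))

  Acyclic : Set
  Acyclic = ∀ u (w : Walk u u) → IsCycle w → ⊥

  IsTree : Set
  IsTree = Connected × Acyclic

  degree : Fin n → ℕ
  degree k = sum (map (λ j → if adj k j then 1 else 0) (allFin n))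

  -- (v_p , v_k) is a directed edge of T^(i) (edges directed away from v_i):
  -- p,k adjacent and v_p is reachable from v_i without passing through v_k.
  Arc : (i p k : Fin n) → Set
  Arc i p k = Adj p k × Σ (Walk i p) (λ w → k ∉ verts w)

ℕ→ℚ : ℕ → ℚ
ℕ→ℚ d = + d ℚ./ 1

-- total reciprocal (1/0 := 0); only applied to multipliers, which are ≥ 2
inv : ℚ → ℚ
inv q with q ℚ.≟ 0ℚ
... | yes _ = 0ℚ
... | no q≢0 = ℚ.1/_ q {{ℚ.≢-nonZero q≢0}}

sumℚ : List ℚ → ℚ
sumℚ = foldr ℚ._+_ 0ℚ

{-# OPTIONS --safe #-}
-- The bounds propagate from the pendant vertices towards v_i. If every child multiplier m_kj is
-- at least 2, each 1/m_kj lies in [0, ½], so their sum over the c children of v_k lies in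
-- [0, c/2]; as v_k is also adjacent to its parent, c ≤ d_k − 1, which places
-- m_pk = d_k + 1 − Σ 1/m_kj in [d_k/2 + 3/2, d_k + 1], and d_k ≥ 1 makes the lower end ≥ 2.
-- Acyclicity is used twice: the parent of v_k is not among its children, and a chain of arcs is
-- a simple path, so the recursion has depth below n.
module Submission where

open import Defs
open import Data.Bool using (Bool; true; T; if_then_else_)
open import Data.Bool.Properties using (T-≡)
open import Data.Empty using (⊥-elim)
open import Data.Fin using (Fin; zero; suc)
open import Data.Fin.Properties using (_≟_)
open import Data.Integer as ℤ using (+_)
import Data.Integer.Properties as ℤ
open import Data.List using (List; []; _∷_; _++_; _ʳ++_; length; map; allFin; filter)
import Data.List.Properties as List
open import Data.List.Membership.Propositional using (_∈_; _∉_)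
open import Data.List.Membership.Propositional.Properties
  using (∈-++⁺ˡ; ∈-++⁺ʳ; ∈-++⁻; ∈-∃++; ∈-allFin; ∈-filter⁺; ∈-filter⁻)
open import Data.List.Relation.Binary.Subset.Propositional using (_⊆_)
open import Data.List.Relation.Binary.Subset.Propositional.Properties using (∷⁺ʳ; xs⊆ys++xs)
open import Data.List.Relation.Unary.All as All using (All; []; _∷_)
open import Data.List.Relation.Unary.All.Properties using (¬Any⇒All¬; ++⁻ˡ)
open import Data.List.Relation.Unary.Any using (here; there)
open import Data.List.Relation.Unary.Linked using (Linked; [-]; _∷_)
open import Data.List.Relation.Unary.Unique.Propositional using (Unique; []; _∷_)
open import Data.List.Relation.Unary.Unique.Propositional.Properties using (allFin⁺; filter⁺)
open import Data.Nat as ℕ using (ℕ; zero; suc; z≤n; s≤s)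
import Data.Nat.Coprimality as Coprime
open import Data.Nat.ListAction using (sum)
import Data.Nat.Properties as ℕ
open import Data.Product using (Σ; ∃; _×_; _,_; proj₁; proj₂)
open import Data.Rational
  using (ℚ; mkℚ; 0ℚ; 1ℚ; ½; _/_; _+_; _-_; _*_; -_; 1/_; _≤_; *≤*; *<*; NonZero; Positive; NonNegative; ≢-nonZero; positive)
import Data.Rational.Properties as ℚ
open import Data.Rational.Solver using (module +-*-Solver)
open import Data.Sum using (inj₁; inj₂)
open import Data.Unit using (⊤; tt)
open import Function using (id; const; _∘_)
open import Function.Bundles using (_⇔_; mk⇔; Equivalence)
open import Relation.Nullary using (¬_; Dec; yes; no)
open import Relation.Nullary.Decidable using (decidable-stable; _×-dec_; ¬¬-excluded-middle)
open import Relation.Nullary.Negation using (¬¬-map)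
open import Relation.Binary.PropositionalEquality

ℕ→ℚ≡mkℚ : ∀ d → ℕ→ℚ d ≡ mkℚ (+ d) 0 (Coprime.sym (Coprime.1-coprimeTo d))
ℕ→ℚ≡mkℚ d = ℚ.normalize-coprime (Coprime.sym (Coprime.1-coprimeTo d))

ℕ→ℚ-suc : ∀ d → ℕ→ℚ (suc d) ≡ 1ℚ + ℕ→ℚ d
ℕ→ℚ-suc d rewrite ℕ→ℚ≡mkℚ d = ℚ./-cong (cong (ℤ._+_ (+ 1)) (sym (ℤ.*-identityʳ (+ d)))) refl

ℕ→ℚ-mono-≤ : ∀ {a b} → a ℕ.≤ b → ℕ→ℚ a ≤ ℕ→ℚ b
ℕ→ℚ-mono-≤ {a} {b} a≤b rewrite ℕ→ℚ≡mkℚ a | ℕ→ℚ≡mkℚ b = *≤* (ℤ.*-monoʳ-≤-nonNeg (+ 1) (ℤ.+≤+ a≤b))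

-‿antimonoʳ-≤ : ∀ p {q r} → q ≤ r → p - r ≤ p - q
-‿antimonoʳ-≤ p q≤r = ℚ.+-monoʳ-≤ p (ℚ.neg-antimono-≤ q≤r)

p-q≤p : ∀ p {q} → 0ℚ ≤ q → p - q ≤ p
p-q≤p p 0≤q = subst (p - _ ≤_) (ℚ.+-identityʳ p) (-‿antimonoʳ-≤ p 0≤q)

inv∈[0,½] : ∀ q → ℕ→ℚ 2 ≤ q → 0ℚ ≤ inv q × inv q ≤ ½
inv∈[0,½] q 2≤q with q ℚ.≟ 0ℚ
... | yes refl with *≤* (ℤ.+≤+ ()) ← 2≤q
... | no q≢0 = ℚ.nonNegative⁻¹ (1/ q) {{1/q-nonNeg}} , 1/q≤½
  where
  instance
    q-nonZero : NonZero q
    q-nonZero = ≢-nonZero q≢0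
  1/q-pos : Positive (1/ q)
  1/q-pos = ℚ.1/pos⇒pos q {{positive (ℚ.<-≤-trans (*<* (ℤ.+<+ (s≤s z≤n))) 2≤q)}}
  1/q-nonNeg : NonNegative (1/ q)
  1/q-nonNeg = ℚ.pos⇒nonNeg (1/ q) {{1/q-pos}}
  open ℚ.≤-Reasoning
  1/q≤½ : 1/ q ≤ ½
  1/q≤½ = begin
    1/ q            ≡⟨ ℚ.*-identityʳ (1/ q) ⟨
    1/ q * 1ℚ       ≤⟨ ℚ.*-monoˡ-≤-nonNeg (1/ q) {{1/q-nonNeg}} (ℚ.*-monoʳ-≤-nonNeg ½ 2≤q) ⟩
    1/ q * (q * ½)  ≡⟨ ℚ.*-assoc (1/ q) q ½ ⟨
    1/ q * q * ½    ≡⟨ cong (_* ½) (ℚ.*-inverseˡ q) ⟩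
    1ℚ * ½          ≡⟨ ℚ.*-identityˡ ½ ⟩
    ½               ∎

sumℚ-inv∈[0,½length] : ∀ {A : Set} (f : A → ℚ) (xs : List A) → All (λ x → ℕ→ℚ 2 ≤ f x) xs →
  0ℚ ≤ sumℚ (map (λ x → inv (f x)) xs) × sumℚ (map (λ x → inv (f x)) xs) ≤ ½ * ℕ→ℚ (length xs)
sumℚ-inv∈[0,½length] f [] [] = ℚ.≤-refl , ℚ.≤-refl
sumℚ-inv∈[0,½length] f (x ∷ xs) (2≤fx ∷ 2≤fxs)
  with inv∈[0,½] (f x) 2≤fx | sumℚ-inv∈[0,½length] f xs 2≤fxs
... | 0≤ix , ix≤½ | 0≤s , s≤½l =
  ℚ.+-mono-≤ 0≤ix 0≤s , ℚ.≤-trans (ℚ.+-mono-≤ ix≤½ s≤½l) (ℚ.≤-reflexive ½+½l≡½[1+l])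
  where
  open ≡-Reasoning
  l = ℕ→ℚ (length xs)
  ½+½l≡½[1+l] : ½ + ½ * l ≡ ½ * ℕ→ℚ (suc (length xs))
  ½+½l≡½[1+l] = begin
    ½ + ½ * l                  ≡⟨ cong (_+ ½ * l) (ℚ.*-identityʳ ½) ⟨
    ½ * 1ℚ + ½ * l             ≡⟨ ℚ.*-distribˡ-+ ½ 1ℚ l ⟨
    ½ * (1ℚ + l)               ≡⟨ cong (½ *_) (ℕ→ℚ-suc (length xs)) ⟨
    ½ * ℕ→ℚ (suc (length xs))  ∎

multiplier-bounds : ∀ {c d} (s : ℚ) → suc c ℕ.≤ d → 0ℚ ≤ s × s ≤ ½ * ℕ→ℚ c →
  (½ * ℕ→ℚ d + + 3 / 2 ≤ ℕ→ℚ d + ℕ→ℚ 1 - s) × (ℕ→ℚ d + ℕ→ℚ 1 - s ≤ ℕ→ℚ d + ℕ→ℚ 1)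
multiplier-bounds {c} {d} s c<d (0≤s , s≤½c) = lower , p-q≤p (D + 1ℚ) 0≤s
  where
  open +-*-Solver
  open ℚ.≤-Reasoning
  C = ℕ→ℚ c
  D = ℕ→ℚ d
  C≤D-1 : C ≤ D - 1ℚ
  C≤D-1 = begin
    C                 ≡⟨ solve 1 (λ C → C := con 1ℚ :+ C :- con 1ℚ) refl C ⟩
    1ℚ + C - 1ℚ       ≡⟨ cong (_- 1ℚ) (ℕ→ℚ-suc c) ⟨
    ℕ→ℚ (suc c) - 1ℚ  ≤⟨ ℚ.+-monoˡ-≤ (- 1ℚ) (ℕ→ℚ-mono-≤ c<d) ⟩
    D - 1ℚ            ∎
  lower : ½ * D + + 3 / 2 ≤ D + 1ℚ - s
  lower = begin
    ½ * D + + 3 / 2        ≡⟨ solve 1 (λ D → con ½ :* D :+ con (+ 3 / 2) := D :+ con 1ℚ :- con ½ :* (D :- con 1ℚ)) refl D ⟩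
    D + 1ℚ - ½ * (D - 1ℚ)  ≤⟨ -‿antimonoʳ-≤ (D + 1ℚ) (ℚ.*-monoˡ-≤-nonNeg ½ C≤D-1) ⟩
    D + 1ℚ - ½ * C         ≤⟨ -‿antimonoʳ-≤ (D + 1ℚ) s≤½c ⟩
    D + 1ℚ - s             ∎

2≤½d+3/2 : ∀ {d} → 1 ℕ.≤ d → ℕ→ℚ 2 ≤ ½ * ℕ→ℚ d + + 3 / 2
2≤½d+3/2 1≤d = ℚ.+-monoˡ-≤ (+ 3 / 2) (ℚ.*-monoˡ-≤-nonNeg ½ (ℕ→ℚ-mono-≤ 1≤d))

bounds-collapse-at-1 : ∀ {d x} → d ≡ 1 → (½ * ℕ→ℚ d + + 3 / 2 ≤ x) × (x ≤ ℕ→ℚ d + ℕ→ℚ 1) →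
  (ℕ→ℚ 2 ≡ ½ * ℕ→ℚ d + + 3 / 2) × (½ * ℕ→ℚ d + + 3 / 2 ≡ x) × (x ≡ ℕ→ℚ d + ℕ→ℚ 1)
bounds-collapse-at-1 refl (lo , hi) = refl , ℚ.≤-antisym lo hi , ℚ.≤-antisym hi lo

count : {A : Set} → (A → Bool) → List A → ℕ
count f xs = sum (map (λ x → if f x then 1 else 0) xs)

count-++ : ∀ {A : Set} (f : A → Bool) xs ys → count f (xs ++ ys) ≡ count f xs ℕ.+ count f ys
count-++ f []       ys = refl
count-++ f (x ∷ xs) ys = trans (cong (_ ℕ.+_) (count-++ f xs ys)) (sym (ℕ.+-assoc (if f x then 1 else 0) _ _))

count-∷-T : ∀ {A : Set} (f : A → Bool) {x} ys → T (f x) → count f (x ∷ ys) ≡ suc (count f ys)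
count-∷-T f ys fx rewrite Equivalence.to T-≡ fx = refl

count-true : ∀ {A : Set} (xs : List A) → count (const true) xs ≡ length xs
count-true []       = refl
count-true (x ∷ xs) = cong suc (count-true xs)

length≤count : ∀ {A : Set} (f : A → Bool) {xs ys : List A} →
  Unique xs → xs ⊆ ys → All (T ∘ f) xs → length xs ℕ.≤ count f ys
length≤count f {[]}     []          _     []          = z≤n
length≤count f {x ∷ xs} (x∉xs ∷ xs!) xs⊆ys (fx ∷ fxs) with ∈-∃++ (xs⊆ys (here refl))
... | as , bs , refl = begin
  suc (length xs)                  ≤⟨ s≤s (length≤count f xs! xs⊆as++bs fxs) ⟩
  suc (count f (as ++ bs))         ≡⟨ cong suc (count-++ f as bs) ⟩
  suc (count f as ℕ.+ count f bs)  ≡⟨ ℕ.+-suc (count f as) (count f bs) ⟨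
  count f as ℕ.+ suc (count f bs)  ≡⟨ cong (count f as ℕ.+_) (count-∷-T f bs fx) ⟨
  count f as ℕ.+ count f (x ∷ bs)  ≡⟨ count-++ f as (x ∷ bs) ⟨
  count f (as ++ x ∷ bs)           ∎
  where
  open ℕ.≤-Reasoning
  xs⊆as++bs : xs ⊆ as ++ bs
  xs⊆as++bs y∈xs with ∈-++⁻ as (xs⊆ys (there y∈xs))
  ... | inj₁ y∈as         = ∈-++⁺ˡ y∈as
  ... | inj₂ (here refl)  = ⊥-elim (All.lookup x∉xs y∈xs refl)
  ... | inj₂ (there y∈bs) = ∈-++⁺ʳ as y∈bs

Unique⇒length≤ : ∀ {n} {xs : List (Fin n)} → Unique xs → length xs ℕ.≤ n
Unique⇒length≤ {n} {xs} xs! = begin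
  length xs                      ≤⟨ length≤count (const true) xs! (λ {x} _ → ∈-allFin x) (All.universal (λ _ → _) xs) ⟩
  count (const true) (allFin n)  ≡⟨ count-true (allFin n) ⟩
  length (allFin n)              ≡⟨ List.length-tabulate id ⟩
  n                              ∎
  where open ℕ.≤-Reasoning

¬¬-decidable : ∀ {n} (P : Fin n → Set) → ¬ ¬ (∀ j → Dec (P j))
¬¬-decidable {zero}  P ¬P? = ¬P? (λ ())
¬¬-decidable {suc n} P ¬P? = ¬¬-excluded-middle λ P0? → ¬¬-decidable (P ∘ suc) λ P∘suc? →
  ¬P? λ { zero → P0? ; (suc j) → P∘suc? j }

Enumeration : ∀ {n} → (Fin n → Set) → Set
Enumeration {n} P = Σ (List (Fin n)) λ cs → Unique cs × (∀ j → (j ∈ cs) ⇔ P j)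

¬¬-enumeration : ∀ {n} (P : Fin n → Set) → ¬ ¬ Enumeration P
¬¬-enumeration {n} P = ¬¬-map enumerate (¬¬-decidable P)
  where
  enumerate : (∀ j → Dec (P j)) → Enumeration P
  enumerate P? = filter P? (allFin n) , filter⁺ P? (allFin⁺ n) ,
    λ j → mk⇔ (proj₂ ∘ ∈-filter⁻ P? {xs = allFin n}) (∈-filter⁺ P? (∈-allFin j))

module _ {A : Set} where

  NonBacktracking : List A → Set
  NonBacktracking (x ∷ y ∷ z ∷ xs) = x ≢ z × NonBacktracking (y ∷ z ∷ xs)
  NonBacktracking _                = ⊤

  NonBacktracking-tail : ∀ {x} xs → NonBacktracking (x ∷ xs) → NonBacktracking xs
  NonBacktracking-tail []           _        = tt
  NonBacktracking-tail (y ∷ [])     _        = tt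
  NonBacktracking-tail (y ∷ z ∷ xs) (_ , nb) = nb

  Unique⇒NonBacktracking : ∀ {xs} → Unique xs → NonBacktracking xs
  Unique⇒NonBacktracking {[]}              _                    = tt
  Unique⇒NonBacktracking {x ∷ []}          _                    = tt
  Unique⇒NonBacktracking {x ∷ y ∷ []}      _                    = tt
  Unique⇒NonBacktracking {x ∷ y ∷ z ∷ xs} ((_ ∷ x≢z ∷ _) ∷ xs!) = x≢z , Unique⇒NonBacktracking xs!

  DistinctHeads : List A → List A → Set
  DistinctHeads (x ∷ _) (y ∷ _) = x ≢ y
  DistinctHeads _       _       = ⊤

  NonBacktracking-ʳ++ : ∀ x xs ys → NonBacktracking (x ∷ xs) → NonBacktracking (x ∷ ys) →
    DistinctHeads xs ys → NonBacktracking (xs ʳ++ x ∷ ys)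
  NonBacktracking-ʳ++ x []       ys _    nb-ys _  = nb-ys
  NonBacktracking-ʳ++ x (y ∷ xs) ys nb-xs nb-ys y≢ys =
    NonBacktracking-ʳ++ y xs (x ∷ ys) (NonBacktracking-tail (y ∷ xs) nb-xs) (turn ys nb-ys y≢ys) (distinct xs nb-xs)
    where
    turn : ∀ ys → NonBacktracking (x ∷ ys) → DistinctHeads (y ∷ xs) ys → NonBacktracking (y ∷ x ∷ ys)
    turn []       _  _   = tt
    turn (z ∷ zs) nb y≢z = y≢z , nb
    distinct : ∀ xs → NonBacktracking (x ∷ y ∷ xs) → DistinctHeads xs (x ∷ ys)
    distinct []       _          = tt
    distinct (z ∷ zs) (x≢z , _) = x≢z ∘ sym

  Unique-++⁻ˡ : ∀ xs {ys : List A} → Unique (xs ++ ys) → Unique xs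
  Unique-++⁻ˡ []       _          = []
  Unique-++⁻ˡ (x ∷ xs) (x∉ ∷ xs!) = ++⁻ˡ xs x∉ ∷ Unique-++⁻ˡ xs xs!

  Unique-++⁻ʳ : ∀ xs {ys : List A} → Unique (xs ++ ys) → Unique ys
  Unique-++⁻ʳ []       ys!        = ys!
  Unique-++⁻ʳ (x ∷ xs) (_ ∷ xs!) = Unique-++⁻ʳ xs xs!

module _ {n : ℕ} (G : Graph n) where

  open import Data.List.Membership.DecPropositional (_≟_ {n}) using (_∈?_)

  Adj-sym : ∀ {u v} → Adj G u v → Adj G v u
  Adj-sym {u} {v} = subst T (Graph.sym G u v)

  Adj-irrefl : ∀ {u} → ¬ Adj G u u
  Adj-irrefl {u} = subst T (Graph.irrefl G u)

  length≤degree : ∀ {k xs} → Unique xs → All (Adj G k) xs → length xs ℕ.≤ degree G k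
  length≤degree {k} xs! adj = length≤count (Graph.adj G k) xs! (λ {x} _ → ∈-allFin x) adj

  Adj⇒degree≥1 : ∀ {k j} → Adj G k j → 1 ℕ.≤ degree G k
  Adj⇒degree≥1 k~j = length≤degree ([] ∷ []) (k~j ∷ [])

  verts-head : ∀ {u t} (w : Walk G u t) → verts G w ≡ u ∷ inner G w
  verts-head here         = refl
  verts-head (step v a w) = refl

  fromLinked : ∀ x xs → Linked (Adj G) (x ∷ xs) → ∃ λ t → Σ (Walk G x t) λ w → verts G w ≡ x ∷ xs
  fromLinked x []       [-]         = x , here , refl
  fromLinked x (y ∷ xs) (x~y ∷ lnk) with fromLinked y xs lnk
  ... | t , w , eq = t , step y x~y w , cong (x ∷_) eq

  splitAt : ∀ {u t x} (w : Walk G u t) → x ∈ verts G w →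
    Σ (Walk G u x) λ pre → Σ (Walk G x t) λ suf → verts G w ≡ verts G pre ++ inner G suf
  splitAt here         (here refl) = here , here , refl
  splitAt (step y a w) (here refl) = here , step y a w , refl
  splitAt {u} (step y a w) (there x∈w) with splitAt w x∈w
  ... | pre , suf , eq = step y a pre , suf , cong (u ∷_) eq

  dropUntil : ∀ {u t x} (w : Walk G u t) → x ∈ verts G w →
    Σ (Walk G x t) λ suf → ∃ λ ys → verts G w ≡ ys ++ verts G suf
  dropUntil here         (here refl) = here , [] , refl
  dropUntil (step y a w) (here refl) = step y a w , [] , refl
  dropUntil {u} (step y a w) (there x∈w) with dropUntil w x∈w
  ... | suf , ys , eq = suf , u ∷ ys , cong (u ∷_) eq

  loopErase : ∀ {u t} (w : Walk G u t) → Σ (Walk G u t) λ w′ → Unique (verts G w′) × verts G w′ ⊆ verts G w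
  loopErase here = here , [] ∷ [] , id
  loopErase {u} (step v a w) with loopErase w
  ... | w′ , w′! , w′⊆w with u ∈? verts G w′
  ...   | no u∉w′ = step v a w′ , ¬Any⇒All¬ _ u∉w′ ∷ w′! , ∷⁺ʳ u w′⊆w
  ...   | yes u∈w′ with dropUntil w′ u∈w′
  ...     | suf , ys , eq =
    suf , Unique-++⁻ʳ ys (subst Unique eq w′!) , there ∘ w′⊆w ∘ subst (_ ∈_) (sym eq) ∘ xs⊆ys++xs _ ys

  reverseOnto : ∀ {u v t} → Walk G u v → Walk G u t → Walk G v t
  reverseOnto here         acc = acc
  reverseOnto {u} (step x a w) acc = reverseOnto w (step u (Adj-sym a) acc)

  verts-reverseOnto : ∀ {u v t} (w : Walk G u v) (acc : Walk G u t) →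
    verts G (reverseOnto w acc) ≡ inner G w ʳ++ verts G acc
  verts-reverseOnto here         acc = refl
  verts-reverseOnto {u} (step x a w) acc rewrite verts-head w = verts-reverseOnto w (step u (Adj-sym a) acc)

  closedWalk-length≥3 : ∀ {u v} {rest : List (Fin n)} → Adj G u v → (w : Walk G v u) →
    NonBacktracking (u ∷ verts G w ++ rest) → 3 ℕ.≤ length (verts G w)
  closedWalk-length≥3 u~v here                         _         = ⊥-elim (Adj-irrefl u~v)
  closedWalk-length≥3 _   (step _ _ here)              (u≢u , _) = ⊥-elim (u≢u refl)
  closedWalk-length≥3 _   (step _ _ (step _ _ w)) _ rewrite verts-head w = s≤s (s≤s (s≤s z≤n))

module _ {n : ℕ} {G : Graph n} (acyclic : Acyclic G) where

  nonBacktracking⇒unique : ∀ {u t} (w : Walk G u t) → NonBacktracking (verts G w) → Unique (verts G w)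
  nonBacktracking⇒unique here _ = [] ∷ []
  nonBacktracking⇒unique {u} (step v u~v w) nb = ¬Any⇒All¬ (verts G w) u∉w ∷ w!
    where
    w! : Unique (verts G w)
    w! = nonBacktracking⇒unique w (NonBacktracking-tail (verts G w) nb)
    u∉w : u ∉ verts G w
    u∉w u∈w with splitAt G w u∈w
    ... | pre , suf , eq = acyclic u (step v u~v pre)
      ( Unique-++⁻ˡ (verts G pre) (subst Unique eq w!)
      , closedWalk-length≥3 G u~v pre (subst (λ vs → NonBacktracking (u ∷ vs)) eq nb))

  linked⇒unique : ∀ {xs} → Linked (Adj G) xs → NonBacktracking xs → Unique xs
  linked⇒unique {[]}     _   _  = []
  linked⇒unique {x ∷ xs} lnk nb with fromLinked G x xs lnk
  ... | _ , w , eq = subst Unique eq (nonBacktracking⇒unique w (subst NonBacktracking (sym eq) nb))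

  -- Strip the common prefix of the two paths; where they first diverge, the edge k ~ p closes a cycle.
  avoidingPaths⇒¬Adj : ∀ {c p k} (A : Walk G c p) (B : Walk G c k) → Unique (verts G A) → Unique (verts G B) →
    k ∉ verts G A → p ∉ verts G B → ¬ Adj G k p
  avoidingPaths⇒¬Adj here B _ _ _ p∉B _ = p∉B (subst (_ ∈_) (sym (verts-head G B)) (here refl))
  avoidingPaths⇒¬Adj (step _ _ _) here _ _ k∉A _ _ = k∉A (here refl)
  avoidingPaths⇒¬Adj {c} {p} {k} (step y c~y A′) (step y′ c~y′ B′) A!@(_ ∷ A′!) B!@(_ ∷ B′!) k∉A p∉B k~p with y ≟ y′
  ... | yes refl = avoidingPaths⇒¬Adj A′ B′ A′! B′! (k∉A ∘ there) (p∉B ∘ there) k~p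
  ... | no y≢y′ = acyclic k (step p k~p C) (C! , 3≤|C|)
    where
    C : Walk G p k
    C = reverseOnto G (step y c~y A′) (step y′ c~y′ B′)
    C≡ : verts G C ≡ verts G A′ ʳ++ c ∷ verts G B′
    C≡ = verts-reverseOnto G (step y c~y A′) (step y′ c~y′ B′)
    C! : Unique (verts G C)
    C! = nonBacktracking⇒unique C (subst NonBacktracking (sym C≡)
      (NonBacktracking-ʳ++ c (verts G A′) (verts G B′)
        (Unique⇒NonBacktracking A!) (Unique⇒NonBacktracking B!)
        (subst₂ DistinctHeads (sym (verts-head G A′)) (sym (verts-head G B′)) y≢y′)))
    3≤|C| : 3 ℕ.≤ length (verts G C)
    3≤|C| rewrite C≡ | List.length-ʳ++ (verts G A′) {c ∷ verts G B′} | verts-head G A′ | verts-head G B′ =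
      s≤s (ℕ.≤-trans (s≤s (s≤s z≤n)) (ℕ.m≤n+m _ (length (inner G A′))))

  Arc-asym : ∀ {i p k} → Arc G i p k → ¬ Arc G i k p
  Arc-asym (_ , w₁ , k∉w₁) (k~p , w₂ , p∉w₂) with loopErase G w₁ | loopErase G w₂
  ... | A , A! , A⊆w₁ | B , B! , B⊆w₂ = avoidingPaths⇒¬Adj A B A! B! (k∉w₁ ∘ A⊆w₁) (p∉w₂ ∘ B⊆w₂) k~p

module Multipliers {n : ℕ} (G : Graph n) (acyclic : Acyclic G) (i : Fin n) (m : Fin n → Fin n → ℚ)
  (recursion : ∀ p k → Arc G i p k → (cs : List (Fin n)) → Unique cs →
    (∀ j → (j ∈ cs) ⇔ Arc G i k j) →
    m p k ≡ (ℕ→ℚ (degree G k) + ℕ→ℚ 1) - sumℚ (map (λ j → inv (m k j)) cs)) where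

  Bounded : Fin n → Fin n → Set
  Bounded p k = (½ * ℕ→ℚ (degree G k) + + 3 / 2 ≤ m p k) × (m p k ≤ ℕ→ℚ (degree G k) + ℕ→ℚ 1)

  bounded? : ∀ p k → Dec (Bounded p k)
  bounded? p k = (_ ℚ.≤? _) ×-dec (_ ℚ.≤? _)

  -- k ∷ p ∷ R is the chain of arcs descended so far, read backwards; being a simple path it has
  -- at most n vertices, which bounds the recursion by the fuel r. Arc G i k is not known to be
  -- decidable, so the children of k are only classically enumerable; this suffices because
  -- Bounded p k is decidable.
  bounded-along : ∀ r {R p k} → Linked (Adj G) (k ∷ p ∷ R) → Unique (k ∷ p ∷ R) →
    n ℕ.≤ r ℕ.+ length (p ∷ R) → Arc G i p k → Bounded p k
  bounded-along zero    _    path! n≤|p∷R| _   = ⊥-elim (ℕ.n≮n _ (ℕ.<-≤-trans (Unique⇒length≤ path!) n≤|p∷R|))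
  bounded-along (suc r) {R} {p} {k} path path! n≤ arc =
    decidable-stable (bounded? p k) (¬¬-map from-children (¬¬-enumeration (Arc G i k)))
    where
    from-children : Enumeration (Arc G i k) → Bounded p k
    from-children (cs , cs! , cs⇔children) rewrite recursion p k arc cs cs! cs⇔children =
      multiplier-bounds _ |p∷cs|≤degree (sumℚ-inv∈[0,½length] (m k) cs (All.tabulate 2≤m))
      where
      child : ∀ {j} → j ∈ cs → Arc G i k j
      child {j} = Equivalence.to (cs⇔children j)
      j≢p : ∀ {j} → j ∈ cs → j ≢ p
      j≢p j∈cs refl = Arc-asym acyclic arc (child j∈cs)
      2≤m : ∀ {j} → j ∈ cs → ℕ→ℚ 2 ≤ m k j
      2≤m j∈cs = ℚ.≤-trans (2≤½d+3/2 (Adj⇒degree≥1 G j~k)) (proj₁ (bounded-along r path′ path′! n≤′ (child j∈cs)))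
        where
        j~k = Adj-sym G (proj₁ (child j∈cs))
        path′ = j~k ∷ path
        path′! = linked⇒unique acyclic path′ (j≢p j∈cs , Unique⇒NonBacktracking path!)
        n≤′ = subst (n ℕ.≤_) (sym (ℕ.+-suc r (length (p ∷ R)))) n≤
      |p∷cs|≤degree : suc (length cs) ℕ.≤ degree G k
      |p∷cs|≤degree = length≤degree G (All.tabulate (λ j∈cs → j≢p j∈cs ∘ sym) ∷ cs!)
        (Adj-sym G (proj₁ arc) ∷ All.tabulate (proj₁ ∘ child))

  bounded : ∀ {p k} → Arc G i p k → Bounded p k
  bounded arc = bounded-along n path (linked⇒unique acyclic path tt) (ℕ.m≤m+n n 1) arc
    where path = Adj-sym G (proj₁ arc) ∷ [-]

theorem4p6 : (n : ℕ) (G : Graph n) → IsTree G → (i : Fin n) →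
    (m : Fin n → Fin n → ℚ) →
    (∀ p k → Arc G i p k → (cs : List (Fin n)) → Unique cs →
      (∀ j → (j ∈ cs) ⇔ Arc G i k j) →
      m p k ≡ (ℕ→ℚ (degree G k) + ℕ→ℚ 1) - sumℚ (map (λ j → inv (m k j)) cs)) →
    ∀ p k → Arc G i p k →
      ((ℕ→ℚ 2 ≤ ½ * ℕ→ℚ (degree G k) + + 3 / 2)
        × (½ * ℕ→ℚ (degree G k) + + 3 / 2 ≤ m p k)
        × (m p k ≤ ℕ→ℚ (degree G k) + ℕ→ℚ 1))
      × (degree G k ≡ 1 →
          (ℕ→ℚ 2 ≡ ½ * ℕ→ℚ (degree G k) + + 3 / 2)
          × (½ * ℕ→ℚ (degree G k) + + 3 / 2 ≡ m p k)
          × (m p k ≡ ℕ→ℚ (degree G k) + ℕ→ℚ 1))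
theorem4p6 n G (_ , acyclic) i m recursion p k arc =
  (2≤½d+3/2 (Adj⇒degree≥1 G (Adj-sym G (proj₁ arc))) , m-bounds) , λ pendant → bounds-collapse-at-1 pendant m-bounds
  where
  open Multipliers G acyclic i m recursion
  m-bounds = bounded arc
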